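{- For every integer $n\ge1$ and every digraph $G$ on $n$ vertices, $$D_0(G)\ge\log^*n-\log^*\log^*n-1.$$
   Context: A digraph is a finite non-empty set of vertices with a binary arc relation on it (loops allowed). First order sentences about digraphs use variables ranging over vertices, the relations $=$ and $\mapsto$ ($x\mapsto y$ means $(x,y)$ is an arc), quantifiers $\forall,\exists$, connectives $\vee,\wedge,\neg$ and parentheses. A sentence $\Phi$ defines a digraph $G$ if it is true on $G$ and false on every digraph not isomorphic to $G$. The quantifier depth is the maximum number of nested quantifiers. A sentence is $0$-alternating if negations occur only directly in front of atomic formulas and no sequence of nested quantifiers contains an occurrence of $\forall\exists$ or $\exists\forall$. $D_0(G)$ is the minimum quantifier depth of a $0$-alternating sentence defining $G$. $\log^*n$ is the minimum number of iterations of the binary logarithm needed to bring $n$ to $1$ or below. -}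

module Defs where

open import Data.Nat using (ℕ; zero; suc; _≤_; _⊔_; _∸_)
open import Data.Nat.Logarithm using (⌈log₂_⌉)
open import Data.Bool using (Bool; true; false)
open import Data.Fin using (Fin)
open import Data.Vec using (Vec; []; _∷_; lookup)
open import Data.Product using (Σ; _×_)
open import Data.Empty using (⊥)
open import Data.Unit using (⊤)
open import Relation.Nullary using (¬_)
open import Relation.Binary.PropositionalEquality using (_≡_; _≢_)
open import Function.Bundles using (_↔_; Inverse)

-- A digraph on vertex set Fin n (loops allowed): adjacency x ↦ y iff A x y ≡ true.
Digraph : ℕ → Set
Digraph n = Fin n → Fin n → Bool

Iso : ∀ {n m} → Digraph n → Digraph m → Set
Iso {n} {m} G H =
  Σ (Fin n ↔ Fin m) λ f → ∀ x y → G x y ≡ H (Inverse.to f x) (Inverse.to f y)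

-- First-order formulas in negation normal form (negation only in front of
-- atomic formulas), with k free variables (de Bruijn indices Fin k).
data Formula : ℕ → Set where
  eq    : ∀ {k} → Fin k → Fin k → Formula k
  neq   : ∀ {k} → Fin k → Fin k → Formula k
  arc   : ∀ {k} → Fin k → Fin k → Formula k
  narc  : ∀ {k} → Fin k → Fin k → Formula k
  _∧'_  : ∀ {k} → Formula k → Formula k → Formula k
  _∨'_  : ∀ {k} → Formula k → Formula k → Formula k
  all'  : ∀ {k} → Formula (suc k) → Formula k  -- ∀ (binds index zero)
  ex'   : ∀ {k} → Formula (suc k) → Formula k  -- ∃ (binds index zero)

Sentence : Set
Sentence = Formula 0

depth : ∀ {k} → Formula k → ℕ
depth (eq _ _)   = 0
depth (neq _ _)  = 0
depth (arc _ _)  = 0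
depth (narc _ _) = 0
depth (φ ∧' ψ)   = depth φ ⊔ depth ψ
depth (φ ∨' ψ)   = depth φ ⊔ depth ψ
depth (all' φ)   = suc (depth φ)
depth (ex' φ)    = suc (depth φ)

Sat : ∀ {n k} → Digraph n → Vec (Fin n) k → Formula k → Set
Sat G ρ (eq x y)   = lookup ρ x ≡ lookup ρ y
Sat G ρ (neq x y)  = lookup ρ x ≢ lookup ρ y
Sat G ρ (arc x y)  = G (lookup ρ x) (lookup ρ y) ≡ true
Sat G ρ (narc x y) = G (lookup ρ x) (lookup ρ y) ≡ false
Sat G ρ (φ ∧' ψ)   = Sat G ρ φ × Sat G ρ ψ
Sat G ρ (φ ∨' ψ)   = Sat G ρ φ ⊎' Sat G ρ ψ
  where open import Data.Sum renaming (_⊎_ to _⊎'_)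
Sat {n} G ρ (all' φ) = (v : Fin n) → Sat G (v ∷ ρ) φ
Sat {n} G ρ (ex' φ)  = Σ (Fin n) λ v → Sat G (v ∷ ρ) φ

NoForall : ∀ {k} → Formula k → Set
NoForall (φ ∧' ψ) = NoForall φ × NoForall ψ
NoForall (φ ∨' ψ) = NoForall φ × NoForall ψ
NoForall (all' φ) = ⊥
NoForall (ex' φ)  = NoForall φ
NoForall _        = ⊤

NoExists : ∀ {k} → Formula k → Set
NoExists (φ ∧' ψ) = NoExists φ × NoExists ψ
NoExists (φ ∨' ψ) = NoExists φ × NoExists ψ
NoExists (all' φ) = NoExists φ
NoExists (ex' φ)  = ⊥
NoExists _        = ⊤

-- 0-alternating: (negations only on atoms, built into Formula) and no chain of
-- nested quantifiers contains ∀∃ or ∃∀, i.e. below an ∃ only ∃'s occur and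
-- below a ∀ only ∀'s occur.
ZeroAlt : ∀ {k} → Formula k → Set
ZeroAlt (φ ∧' ψ) = ZeroAlt φ × ZeroAlt ψ
ZeroAlt (φ ∨' ψ) = ZeroAlt φ × ZeroAlt ψ
ZeroAlt (all' φ) = NoExists φ
ZeroAlt (ex' φ)  = NoForall φ
ZeroAlt _        = ⊤

Defines : ∀ {n} → Digraph n → Sentence → Set
Defines {n} G Φ =
  Sat G [] Φ ×
  (∀ m → 1 ≤ m → (H : Digraph m) → ¬ Iso G H → ¬ Sat H [] Φ)

-- log* n: number of iterations of the binary logarithm needed to bring n to ≤ 1.
-- For reals y, log*(y) = log*(⌈y⌉) (the thresholds 1,2,4,16,... are integers),
-- so iterating ⌈log₂_⌉ on naturals gives the same value.  The first argument is
-- fuel; n units of fuel always suffice since log* n ≤ n.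
logStar′ : ℕ → ℕ → ℕ
logStar′ zero    _             = 0
logStar′ (suc f) zero          = 0
logStar′ (suc f) (suc zero)    = 0
logStar′ (suc f) (suc (suc m)) = suc (logStar′ f ⌈log₂ suc (suc m) ⌉)

logStar : ℕ → ℕ
logStar n = logStar′ n n

-- A 0-alternating sentence is a Boolean combination of universal and existential
-- sentences. Universal sentences pass from G to every induced subgraph. An
-- existential sentence of depth d passes from G to G - v as soon as Duplicator wins
-- the d-round Ehrenfeucht–Fraïssé game in which Spoiler only plays in G. Picking,
-- round after round, one vertex realising each existential type gives a set W of
-- witnesses such that every v ∉ W has this property, and |W| is at most a tower of 2's
-- of height d + 1 over 4 + d. If Φ defines G, then G - v must falsify Φ, so n ≤ |W|, and
-- log* |W| ≤ d + 1 + log* (4 + d) yields the bound.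
module Submission where

open import Defs
open import Data.Nat using (ℕ; _≤_; _∸_)
open import Data.Product using (_×_)

open import Data.Bool using (Bool; true; false; T)
open import Data.Bool.Properties using () renaming (_≟_ to _≟ᵇ_)
open import Data.Fin using (Fin; suc; punchIn; punchOut)
open import Data.Fin.Properties
  using (any?; ¬∀⟶∃¬; punchIn-injective; punchIn-punchOut; injective⇒≤)
  renaming (_≟_ to _≟ᶠ_)
open import Data.List as List
  using (List; []; _∷_; [_]; _++_; length; concatMap; cartesianProductWith; cartesianProduct)
open import Data.List.Properties using (length-++; length-map)
open import Data.List.Membership.Propositional using (_∈_; _∉_)
open import Data.List.Membership.Propositional.Properties
  using (∈-map⁺; ∈-concat⁺′; ∈-cartesianProductWith⁺; ∈-cartesianProduct⁺)
open import Data.List.Membership.Setoid.Properties using (index-injective)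
open import Data.List.Relation.Unary.Any as Any using (here; there; index)
open import Data.List.Relation.Unary.Any.Properties using (lookup-index)
open import Data.Nat
  using (zero; suc; _+_; _*_; _^_; _<_; _≤′_; ≤′-refl; ≤′-step; z≤n; s≤s; >-nonZero)
open import Data.Nat.Logarithm using (⌈log₂_⌉; ⌈log₂⌉-mono-≤; ⌈log₂2^n⌉≡n)
open import Data.Nat.Properties hiding (_≟_)
open import Data.Nat.Tactic.RingSolver using (solve-∀)
open import Data.Product using (∃-syntax; _,_; proj₁; proj₂)
open import Data.Product.Properties using () renaming (≡-dec to ×-≡-dec)
open import Data.Sum using (inj₁; inj₂)
open import Data.Vec using (Vec; []; _∷_; lookup; tabulate; map)
open import Data.Vec.Properties
  using (lookup∘tabulate; lookup-map) renaming (≡-dec to Vec-≡-dec)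
open import Function.Base using (_∘_)
open import Function.Bundles using (Injection; _↔_)
open import Function.Definitions using (Injective)
open import Function.Properties.Inverse using (↔⇒↣)
open import Relation.Binary.Definitions using (DecidableEquality)
open import Relation.Binary.PropositionalEquality
  using (_≡_; refl; sym; trans; cong; cong₂; subst; setoid; module ≡-Reasoning)
open import Relation.Nullary using (yes; no; contradiction)
open import Relation.Nullary.Decidable using (⌊_⌋; toWitness; fromWitness)

length-cartesianProductWith : ∀ {A B C : Set} (f : A → B → C) xs ys →
  length (cartesianProductWith f xs ys) ≡ length xs * length ys
length-cartesianProductWith f []       ys = refl
length-cartesianProductWith f (x ∷ xs) ys = begin
  length (List.map (f x) ys ++ cartesianProductWith f xs ys)
    ≡⟨ length-++ (List.map (f x) ys) ⟩
  length (List.map (f x) ys) + length (cartesianProductWith f xs ys)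
    ≡⟨ cong₂ _+_ (length-map (f x) ys) (length-cartesianProductWith f xs ys) ⟩
  length ys + length xs * length ys ∎
  where open ≡-Reasoning

length-concatMap-≤ : ∀ {A B : Set} (f : A → List B) {M} →
  (∀ x → length (f x) ≤ M) → ∀ xs → length (concatMap f xs) ≤ length xs * M
length-concatMap-≤ f bound []       = z≤n
length-concatMap-≤ f {M} bound (x ∷ xs) = begin
  length (f x ++ concatMap f xs)         ≡⟨ length-++ (f x) ⟩
  length (f x) + length (concatMap f xs) ≤⟨ +-mono-≤ (bound x) (length-concatMap-≤ f bound xs) ⟩
  M + length xs * M                      ∎
  where open ≤-Reasoning

∈-concatMap⁺′ : ∀ {A B : Set} {f : A → List B} {x y xs} →
  y ∈ f x → x ∈ xs → y ∈ concatMap f xs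
∈-concatMap⁺′ {f = f} y∈fx x∈xs = ∈-concat⁺′ y∈fx (∈-map⁺ f x∈xs)

length<⇒∃∉ : ∀ {N} (xs : List (Fin N)) → length xs < N → ∃[ v ] v ∉ xs
length<⇒∃∉ {N} xs short = ¬∀⟶∃¬ N (_∈ xs) (λ v → Any.any? (v ≟ᶠ_) xs) λ all →
  <⇒≱ short (injective⇒≤ λ {v} {w} → index-injective (setoid (Fin N)) (all v) (all w))

record FinSet : Set₁ where
  field
    Carrier  : Set
    _≟_      : DecidableEquality Carrier
    elements : List Carrier
    complete : ∀ x → x ∈ elements

  size : ℕ
  size = length elements

  indexOf : Carrier → Fin size
  indexOf x = index (complete x)

open FinSet

bools : FinSet
bools = record
  { Carrier  = Bool
  ; _≟_      = _≟ᵇ_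
  ; elements = true ∷ false ∷ []
  ; complete = λ { true → here refl ; false → there (here refl) }
  }

_×ᶠ_ : FinSet → FinSet → FinSet
E ×ᶠ F = record
  { Carrier  = Carrier E × Carrier F
  ; _≟_      = ×-≡-dec (_≟_ E) (_≟_ F)
  ; elements = cartesianProduct (elements E) (elements F)
  ; complete = λ (x , y) → ∈-cartesianProduct⁺ (complete E x) (complete F y)
  }

vectors : ∀ {A : Set} → List A → ∀ k → List (Vec A k)
vectors xs zero    = [ [] ]
vectors xs (suc k) = cartesianProductWith _∷_ xs (vectors xs k)

∈-vectors : ∀ {A : Set} {xs : List A} → (∀ x → x ∈ xs) →
  ∀ {k} (v : Vec A k) → v ∈ vectors xs k
∈-vectors complete []      = here refl
∈-vectors complete (x ∷ v) = ∈-cartesianProductWith⁺ _∷_ (complete x) (∈-vectors complete v)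

length-vectors : ∀ {A : Set} (xs : List A) k → length (vectors xs k) ≡ length xs ^ k
length-vectors xs zero    = refl
length-vectors xs (suc k) =
  trans (length-cartesianProductWith _∷_ xs (vectors xs k)) (cong (length xs *_) (length-vectors xs k))

vecs : ℕ → FinSet → FinSet
vecs k E = record
  { Carrier  = Vec (Carrier E) k
  ; _≟_      = Vec-≡-dec (_≟_ E)
  ; elements = vectors (elements E) k
  ; complete = ∈-vectors (complete E)
  }

size-vecs : ∀ k E → size (vecs k E) ≡ size E ^ k
size-vecs k E = length-vectors (elements E) k

module _ {N} (E : FinSet) (f : Fin N → Carrier E) where

  realizers : Carrier E → List (Fin N)
  realizers c with any? (λ a → _≟_ E (f a) c)
  ... | yes (a , _) = [ a ]
  ... | no _        = []

  length-realizers : ∀ c → length (realizers c) ≤ 1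
  length-realizers c with any? (λ a → _≟_ E (f a) c)
  ... | yes _ = ≤-refl
  ... | no _  = z≤n

  realizer : ∀ a → ∃[ a′ ] a′ ∈ realizers (f a) × f a′ ≡ f a
  realizer a with any? (λ a′ → _≟_ E (f a′) (f a))
  ... | yes (a′ , same) = a′ , here refl , same
  ... | no ∄            = contradiction (a , refl) ∄

  transversal : List (Fin N)
  transversal = concatMap realizers (elements E)

  length-transversal : length transversal ≤ size E
  length-transversal = begin
    length transversal ≤⟨ length-concatMap-≤ realizers length-realizers (elements E) ⟩
    size E * 1         ≡⟨ *-identityʳ (size E) ⟩
    size E             ∎
    where open ≤-Reasoning

  transversal-complete : ∀ a → ∃[ a′ ] a′ ∈ transversal × f a′ ≡ f a
  transversal-complete a with realizer a
  ... | a′ , a′∈ , same = a′ , ∈-concatMap⁺′ a′∈ (complete E (f a)) , same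

-- The existential game

module _ {n m} (G : Digraph n) (H : Digraph m) where

  record PartialIso {k} (ρ : Vec (Fin n) k) (σ : Vec (Fin m) k) : Set where
    field
      ≡⇒≡   : ∀ i j → lookup ρ i ≡ lookup ρ j → lookup σ i ≡ lookup σ j
      ≡⇐≡   : ∀ i j → lookup σ i ≡ lookup σ j → lookup ρ i ≡ lookup ρ j
      arc-≡ : ∀ i j → G (lookup ρ i) (lookup ρ j) ≡ H (lookup σ i) (lookup σ j)

  -- Duplicator wins the r-round game from position (ρ , σ) in which Spoiler always
  -- picks a vertex of G; as usual only the final position is checked.
  Forth : ℕ → ∀ {k} → Vec (Fin n) k → Vec (Fin m) k → Set
  Forth zero    ρ σ = PartialIso ρ σ
  Forth (suc r) ρ σ = ∀ a → ∃[ b ] Forth r (a ∷ ρ) (b ∷ σ)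

open PartialIso

module _ {n m} {G : Digraph n} {H : Digraph m} where

  PartialIso-tail : ∀ {k a b} {ρ : Vec (Fin n) k} {σ} →
    PartialIso G H (a ∷ ρ) (b ∷ σ) → PartialIso G H ρ σ
  PartialIso-tail p = record
    { ≡⇒≡   = λ i j → ≡⇒≡ p (suc i) (suc j)
    ; ≡⇐≡   = λ i j → ≡⇐≡ p (suc i) (suc j)
    ; arc-≡ = λ i j → arc-≡ p (suc i) (suc j)
    }

  -- The vertex lets Spoiler make the remaining moves, which he cannot do in an empty G.
  Forth⇒PartialIso : ∀ r {k} {ρ : Vec (Fin n) k} {σ} →
    Fin n → Forth G H r ρ σ → PartialIso G H ρ σ
  Forth⇒PartialIso zero    _ p = p
  Forth⇒PartialIso (suc r) a w = PartialIso-tail (Forth⇒PartialIso r a (proj₂ (w a)))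

  ∃-preserved : ∀ {r k} (φ : Formula k) {ρ σ} → NoForall φ → depth φ ≤ r →
    Forth G H r ρ σ → Sat G ρ φ → Sat H σ φ
  ∃-preserved {r} (eq x y)   {ρ} _ _ w s = ≡⇒≡ (Forth⇒PartialIso r (lookup ρ x) w) x y s
  ∃-preserved {r} (neq x y)  {ρ} _ _ w s = s ∘ ≡⇐≡ (Forth⇒PartialIso r (lookup ρ x) w) x y
  ∃-preserved {r} (arc x y)  {ρ} _ _ w s = trans (sym (arc-≡ (Forth⇒PartialIso r (lookup ρ x) w) x y)) s
  ∃-preserved {r} (narc x y) {ρ} _ _ w s = trans (sym (arc-≡ (Forth⇒PartialIso r (lookup ρ x) w) x y)) s
  ∃-preserved (φ ∧' ψ) (nfφ , nfψ) d w (sφ , sψ) =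
    ∃-preserved φ nfφ (m⊔n≤o⇒m≤o _ _ d) w sφ ,
    ∃-preserved ψ nfψ (m⊔n≤o⇒n≤o _ _ d) w sψ
  ∃-preserved (φ ∨' ψ) (nfφ , _) d w (inj₁ sφ) =
    inj₁ (∃-preserved φ nfφ (m⊔n≤o⇒m≤o _ _ d) w sφ)
  ∃-preserved (φ ∨' ψ) (_ , nfψ) d w (inj₂ sψ) =
    inj₂ (∃-preserved ψ nfψ (m⊔n≤o⇒n≤o _ _ d) w sψ)
  ∃-preserved (ex' φ) nf (s≤s d) w (a , s) with w a
  ... | b , w′ = b , ∃-preserved φ nf d w′ s

  PartialIso-trans : ∀ {o k} {I : Digraph o} {ρ : Vec (Fin n) k} {σ τ} →
    PartialIso G H ρ σ → PartialIso H I σ τ → PartialIso G I ρ τ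
  PartialIso-trans p q = record
    { ≡⇒≡   = λ i j → ≡⇒≡ q i j ∘ ≡⇒≡ p i j
    ; ≡⇐≡   = λ i j → ≡⇐≡ p i j ∘ ≡⇐≡ q i j
    ; arc-≡ = λ i j → trans (arc-≡ p i j) (arc-≡ q i j)
    }

  Forth-trans : ∀ r {o k} {I : Digraph o} {ρ : Vec (Fin n) k} {σ τ} →
    Forth G H r ρ σ → Forth H I r σ τ → Forth G I r ρ τ
  Forth-trans zero    p q = PartialIso-trans p q
  Forth-trans (suc r) v w a with v a
  ... | b , v′ with w b
  ...   | c , w′ = c , Forth-trans r v′ w′

induced : ∀ {n m} → Digraph n → (Fin m → Fin n) → Digraph m
induced G e x y = G (e x) (e y)

module _ {n m} (G : Digraph n) {e : Fin m → Fin n} (e-injective : Injective _≡_ _≡_ e) where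

  embedding-PartialIso : ∀ {k} (σ : Vec (Fin m) k) → PartialIso G (induced G e) (map e σ) σ
  embedding-PartialIso σ = record
    { ≡⇒≡   = λ i j p → e-injective (trans (sym (lookup-map i e σ)) (trans p (lookup-map j e σ)))
    ; ≡⇐≡   = λ i j p → trans (lookup-map i e σ) (trans (cong e p) (sym (lookup-map j e σ)))
    ; arc-≡ = λ i j → cong₂ G (lookup-map i e σ) (lookup-map j e σ)
    }

  ∀-preserved : ∀ {k} (φ : Formula k) (σ : Vec (Fin m) k) → NoExists φ →
    Sat G (map e σ) φ → Sat (induced G e) σ φ
  ∀-preserved φ@(eq _ _)   σ _ = ∃-preserved φ _ z≤n (embedding-PartialIso σ)
  ∀-preserved φ@(neq _ _)  σ _ = ∃-preserved φ _ z≤n (embedding-PartialIso σ)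
  ∀-preserved φ@(arc _ _)  σ _ = ∃-preserved φ _ z≤n (embedding-PartialIso σ)
  ∀-preserved φ@(narc _ _) σ _ = ∃-preserved φ _ z≤n (embedding-PartialIso σ)
  ∀-preserved (φ ∧' ψ) σ (neφ , neψ) (sφ , sψ) =
    ∀-preserved φ σ neφ sφ , ∀-preserved ψ σ neψ sψ
  ∀-preserved (φ ∨' ψ) σ (neφ , _) (inj₁ sφ) = inj₁ (∀-preserved φ σ neφ sφ)
  ∀-preserved (φ ∨' ψ) σ (_ , neψ) (inj₂ sψ) = inj₂ (∀-preserved ψ σ neψ sψ)
  ∀-preserved (all' φ) σ ne s b = ∀-preserved φ (b ∷ σ) ne (s (e b))

  zeroAlt-preserved : ∀ {d k} (φ : Formula k) (σ : Vec (Fin m) k) → ZeroAlt φ → depth φ ≤ d →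
    Forth G (induced G e) d (map e σ) σ → Sat G (map e σ) φ → Sat (induced G e) σ φ
  zeroAlt-preserved φ@(eq _ _)   σ _  _ _ = ∀-preserved φ σ _
  zeroAlt-preserved φ@(neq _ _)  σ _  _ _ = ∀-preserved φ σ _
  zeroAlt-preserved φ@(arc _ _)  σ _  _ _ = ∀-preserved φ σ _
  zeroAlt-preserved φ@(narc _ _) σ _  _ _ = ∀-preserved φ σ _
  zeroAlt-preserved φ@(all' _)   σ za _ _ = ∀-preserved φ σ za
  zeroAlt-preserved φ@(ex' _)    σ za d w = ∃-preserved φ za d w
  zeroAlt-preserved (φ ∧' ψ) σ (zφ , zψ) d w (sφ , sψ) =
    zeroAlt-preserved φ σ zφ (m⊔n≤o⇒m≤o _ _ d) w sφ ,
    zeroAlt-preserved ψ σ zψ (m⊔n≤o⇒n≤o _ _ d) w sψ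
  zeroAlt-preserved (φ ∨' ψ) σ (zφ , _) d w (inj₁ sφ) =
    inj₁ (zeroAlt-preserved φ σ zφ (m⊔n≤o⇒m≤o _ _ d) w sφ)
  zeroAlt-preserved (φ ∨' ψ) σ (_ , zψ) d w (inj₂ sψ) =
    inj₂ (zeroAlt-preserved ψ σ zψ (m⊔n≤o⇒n≤o _ _ d) w sψ)

-- Existential types and witness sets

-- Types k r codes the r-round existential types of k-tuples: the atomic type (equality
-- and adjacency of every pair of entries) for r = 0, and for r + 1 the characteristic
-- vector of the r-types of one-point extensions that are realised.
Types : ℕ → ℕ → FinSet
Types k zero    = vecs k (vecs k (bools ×ᶠ bools))
Types k (suc r) = vecs (size (Types (suc k) r)) bools

typeCount : ℕ → ℕ → ℕ
typeCount k r = size (Types k r)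

witnessBound : ℕ → ℕ → ℕ
witnessBound k zero    = 0
witnessBound k (suc r) = typeCount (suc k) r * suc (witnessBound (suc k) r)

module _ {N} (G : Digraph N) where

  atomicType : ∀ {k} → Vec (Fin N) k → Carrier (Types k 0)
  atomicType σ = tabulate λ i → tabulate λ j →
    ⌊ lookup σ i ≟ᶠ lookup σ j ⌋ , G (lookup σ i) (lookup σ j)

  type : ∀ r {k} → Vec (Fin N) k → Carrier (Types k r)
  type zero    σ = atomicType σ
  type (suc r) {k} σ = tabulate λ i →
    ⌊ any? (λ a → _≟_ (Types (suc k) r) (type r (a ∷ σ))
                                        (List.lookup (elements (Types (suc k) r)) i)) ⌋

  atomicType-entry : ∀ {k} (σ : Vec (Fin N) k) i j →
    lookup (lookup (atomicType σ) i) j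
      ≡ (⌊ lookup σ i ≟ᶠ lookup σ j ⌋ , G (lookup σ i) (lookup σ j))
  atomicType-entry σ i j =
    trans (cong (λ row → lookup row j) (lookup∘tabulate _ i)) (lookup∘tabulate _ j)

  ⌊≟⌋-transport : ∀ {x y x′ y′ : Fin N} → ⌊ x ≟ᶠ y ⌋ ≡ ⌊ x′ ≟ᶠ y′ ⌋ → x ≡ y → x′ ≡ y′
  ⌊≟⌋-transport same x≡y = toWitness (subst T same (fromWitness x≡y))

  atomicType-PartialIso : ∀ {k} {σ σ′ : Vec (Fin N) k} →
    atomicType σ ≡ atomicType σ′ → PartialIso G G σ σ′
  atomicType-PartialIso {σ = σ} {σ′} same = record
    { ≡⇒≡   = λ i j → ⌊≟⌋-transport (cong proj₁ (entries i j))
    ; ≡⇐≡   = λ i j → ⌊≟⌋-transport (sym (cong proj₁ (entries i j)))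
    ; arc-≡ = λ i j → cong proj₂ (entries i j)
    }
    where
    entries : ∀ i j → (⌊ lookup σ i ≟ᶠ lookup σ j ⌋ , G (lookup σ i) (lookup σ j))
                    ≡ (⌊ lookup σ′ i ≟ᶠ lookup σ′ j ⌋ , G (lookup σ′ i) (lookup σ′ j))
    entries i j = trans (sym (atomicType-entry σ i j))
      (trans (cong (λ t → lookup (lookup t i) j) same) (atomicType-entry σ′ i j))

  realized⇒bit : ∀ r {k} (σ : Vec (Fin N) k) a →
    T (lookup (type (suc r) σ) (indexOf (Types (suc k) r) (type r (a ∷ σ))))
  realized⇒bit r {k} σ a =
    subst T (sym (lookup∘tabulate _ i)) (fromWitness (a , lookup-index (complete (Types (suc k) r) _)))
    where
    i : Fin (typeCount (suc k) r)
    i = indexOf (Types (suc k) r) (type r (a ∷ σ))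

  bit⇒realized : ∀ r {k} (σ : Vec (Fin N) k) i → T (lookup (type (suc r) σ) i) →
    ∃[ b ] type r (b ∷ σ) ≡ List.lookup (elements (Types (suc k) r)) i
  bit⇒realized r σ i bit = toWitness (subst T (lookup∘tabulate _ i) bit)

  sameType⇒Forth : ∀ r {k} {σ σ′ : Vec (Fin N) k} → type r σ ≡ type r σ′ → Forth G G r σ σ′
  sameType⇒Forth zero    same = atomicType-PartialIso same
  sameType⇒Forth (suc r) {k} {σ} {σ′} same a =
    let σ′-realizes = subst (λ t → T (lookup t i)) same (realized⇒bit r σ a)
        (b , b-realizes) = bit⇒realized r σ′ i σ′-realizes
    in b , sameType⇒Forth r (trans (lookup-index (complete (Types (suc k) r) _)) (sym b-realizes))
    where
    i : Fin (typeCount (suc k) r)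
    i = indexOf (Types (suc k) r) (type r (a ∷ σ))

  witnesses : ℕ → ∀ {k} → Vec (Fin N) k → List (Fin N)
  witnesses zero    ρ = []
  witnesses (suc r) {k} ρ =
    concatMap (λ a → a ∷ witnesses r (a ∷ ρ)) (transversal (Types (suc k) r) (λ a → type r (a ∷ ρ)))

  length-witnesses : ∀ r {k} (ρ : Vec (Fin N) k) → length (witnesses r ρ) ≤ witnessBound k r
  length-witnesses zero    ρ = z≤n
  length-witnesses (suc r) {k} ρ = begin
    length (witnesses (suc r) ρ)
      ≤⟨ length-concatMap-≤ _ (λ a → s≤s (length-witnesses r (a ∷ ρ))) reps ⟩
    length reps * suc (witnessBound (suc k) r)
      ≤⟨ *-monoˡ-≤ _ (length-transversal (Types (suc k) r) (λ a → type r (a ∷ ρ))) ⟩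
    witnessBound k (suc r) ∎
    where
    open ≤-Reasoning
    reps : List (Fin N)
    reps = transversal (Types (suc k) r) (λ a → type r (a ∷ ρ))

  -- Spoiler's move a is answered as if it were its representative a′: both have the same
  -- type, and a′ together with its own witnesses lies in the image of e.
  witnesses-suffice : ∀ {m} {e : Fin m → Fin N} → Injective _≡_ _≡_ e →
    ∀ r {k} (σ : Vec (Fin m) k) → (∀ {a} → a ∈ witnesses r (map e σ) → ∃[ b ] e b ≡ a) →
    Forth G (induced G e) r (map e σ) σ
  witnesses-suffice e-injective zero    σ _     = embedding-PartialIso G e-injective σ
  witnesses-suffice {e = e} e-injective (suc r) σ cover a
    with transversal-complete (Types _ r) (λ a → type r (a ∷ _)) a
  ... | a′ , a′∈reps , same with cover (∈-concatMap⁺′ (here refl) a′∈reps)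
  ...   | b , refl =
    b , Forth-trans r (sameType⇒Forth r (sym same)) (witnesses-suffice e-injective r (b ∷ σ) cover′)
    where
    cover′ : ∀ {x} → x ∈ witnesses r (e b ∷ map e σ) → ∃[ c ] e c ≡ x
    cover′ x∈ = cover (∈-concatMap⁺′ (there x∈) a′∈reps)

↔⇒≤ : ∀ {n m} → Fin n ↔ Fin m → n ≤ m
↔⇒≤ f = injective⇒≤ (Injection.injective (↔⇒↣ f))

definable⇒≤witnessBound : ∀ {n} (G : Digraph (suc (suc n))) (Φ : Sentence) →
  ZeroAlt Φ → Defines G Φ → suc (suc n) ≤ witnessBound 0 (depth Φ)
definable⇒≤witnessBound G Φ zeroAlt (G⊨Φ , onlyG) = ≮⇒≥ λ few →
  let W = witnesses G (depth Φ) []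
      (v , v∉W) = length<⇒∃∉ W (≤-<-trans (length-witnesses G (depth Φ) []) few)
      punchIn-inj : Injective _≡_ _≡_ (punchIn v)
      punchIn-inj = punchIn-injective v _ _
      cover : ∀ {a} → a ∈ W → ∃[ b ] punchIn v b ≡ a
      cover a∈W = let v≢a = λ { refl → v∉W a∈W } in punchOut v≢a , punchIn-punchOut v≢a
      G-v⊨Φ : Sat (induced G (punchIn v)) [] Φ
      G-v⊨Φ = zeroAlt-preserved G punchIn-inj Φ [] zeroAlt ≤-refl
                (witnesses-suffice G punchIn-inj (depth Φ) [] cover) G⊨Φ
  in onlyG _ (s≤s z≤n) (induced G (punchIn v)) (1+n≰n ∘ ↔⇒≤ ∘ proj₁) G-v⊨Φ

-- Towers of exponentials

n<2^n : ∀ n → n < 2 ^ n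
n<2^n zero    = s≤s z≤n
n<2^n (suc n) = +-mono-≤ (m^n>0 2 n) (≤-trans (n<2^n n) (m≤m+n _ 0))

2^n+2^n≡2^[1+n] : ∀ n → 2 ^ n + 2 ^ n ≡ 2 ^ suc n
2^n+2^n≡2^[1+n] n = cong (2 ^ n +_) (sym (+-identityʳ _))

m+m≤m*m : ∀ {m} → 2 ≤ m → m + m ≤ m * m
m+m≤m*m {m} 2≤m = ≤-trans (≤-reflexive (cong (m +_) (sym (+-identityʳ m)))) (*-monoˡ-≤ m 2≤m)

square-suc : ∀ n → suc n * suc n ≡ n * n + suc (n + n)
square-suc = solve-∀

1+2n≤2^[1+n] : ∀ n → suc (n + n) ≤ 2 ^ suc n
1+2n≤2^[1+n] n = +-mono-≤ (n<2^n n) (≤-trans (<⇒≤ (n<2^n n)) (m≤m+n _ 0))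

n²≤2^[2+n] : ∀ n → n * n ≤ 2 ^ (2 + n)
n²≤2^[2+n] zero    = z≤n
n²≤2^[2+n] (suc n) = begin
  suc n * suc n             ≡⟨ square-suc n ⟩
  n * n + suc (n + n)       ≤⟨ +-mono-≤ (n²≤2^[2+n] n) 1+2n≤2^[2+n] ⟩
  2 ^ (2 + n) + 2 ^ (2 + n) ≡⟨ 2^n+2^n≡2^[1+n] (2 + n) ⟩
  2 ^ (3 + n)               ∎
  where
  open ≤-Reasoning
  1+2n≤2^[2+n] : suc (n + n) ≤ 2 ^ (2 + n)
  1+2n≤2^[2+n] = ≤-trans (1+2n≤2^[1+n] n) (^-monoʳ-≤ 2 (n≤1+n (suc n)))

1+n²≤2^n : ∀ {n} → 5 ≤′ n → suc (n * n) ≤ 2 ^ n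
1+n²≤2^n ≤′-refl               = m≤m+n 26 6
1+n²≤2^n {suc n} (≤′-step 5≤n) = begin
  suc (suc n * suc n)       ≡⟨ cong suc (square-suc n) ⟩
  suc (n * n) + suc (n + n) ≤⟨ +-mono-≤ IH (≤-trans (s≤s (m+m≤m*m 2≤n)) IH) ⟩
  2 ^ n + 2 ^ n             ≡⟨ 2^n+2^n≡2^[1+n] n ⟩
  2 ^ suc n                 ∎
  where
  open ≤-Reasoning
  IH : suc (n * n) ≤ 2 ^ n
  IH = 1+n²≤2^n 5≤n
  2≤n : 2 ≤ n
  2≤n = ≤-trans (s≤s (s≤s z≤n)) (≤′⇒≤ 5≤n)

tower : ℕ → ℕ → ℕ
tower zero    x = x
tower (suc h) x = 2 ^ tower h x

tower-+ : ∀ a b x → tower a (tower b x) ≡ tower (a + b) x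
tower-+ zero    b x = refl
tower-+ (suc a) b x = cong (2 ^_) (tower-+ a b x)

x≤tower : ∀ h x → x ≤ tower h x
x≤tower zero    x = ≤-refl
x≤tower (suc h) x = ≤-trans (x≤tower h x) (<⇒≤ (n<2^n _))

tower-square : ∀ h {x} → 2 ≤ x → tower h x * tower h x ≤ tower h (x * x)
tower-square zero    2≤x = ≤-refl
tower-square (suc h) {x} 2≤x = begin
  2 ^ t * 2 ^ t       ≡⟨ sym (^-distribˡ-+-* 2 t t) ⟩
  2 ^ (t + t)         ≤⟨ ^-monoʳ-≤ 2 (m+m≤m*m (≤-trans 2≤x (x≤tower h x))) ⟩
  2 ^ (t * t)         ≤⟨ ^-monoʳ-≤ 2 (tower-square h 2≤x) ⟩
  2 ^ tower h (x * x) ∎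
  where
  open ≤-Reasoning
  t : ℕ
  t = tower h x

-- Counting types and witnesses

typeCount-zero : ∀ k → typeCount k 0 ≡ 2 ^ (2 * (k * k))
typeCount-zero k = begin
  size (vecs k (vecs k pairs)) ≡⟨ size-vecs k (vecs k pairs) ⟩
  size (vecs k pairs) ^ k      ≡⟨ cong (_^ k) (size-vecs k pairs) ⟩
  (4 ^ k) ^ k                  ≡⟨ ^-*-assoc 4 k k ⟩
  4 ^ (k * k)                  ≡⟨ ^-*-assoc 2 2 (k * k) ⟩
  2 ^ (2 * (k * k))            ∎
  where
  open ≡-Reasoning
  pairs : FinSet
  pairs = bools ×ᶠ bools

typeCount-suc : ∀ k r → typeCount k (suc r) ≡ 2 ^ typeCount (suc k) r
typeCount-suc k r = size-vecs (typeCount (suc k) r) bools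

m+1+n≤o⇒1+m+n≤o : ∀ m n {o} → m + suc n ≤ o → suc m + n ≤ o
m+1+n≤o⇒1+m+n≤o m n = ≤-trans (≤-reflexive (sym (+-suc m n)))

5≤tower2 : ∀ d → 5 ≤ tower 2 (3 + d)
5≤tower2 d = ≤-trans (m≤m+n 5 251) (^-monoʳ-≤ 2 (^-monoʳ-≤ 2 (m≤m+n 3 d)))

typeCount≤tower : ∀ d k r → k + r ≤ d → typeCount k r ≤ tower r (tower 2 (3 + d))
typeCount≤tower d k zero k+0≤d = begin
  typeCount k 0     ≡⟨ typeCount-zero k ⟩
  2 ^ (2 * (k * k)) ≤⟨ ^-monoʳ-≤ 2 (*-monoʳ-≤ 2 (≤-trans (*-mono-≤ k≤d k≤d) (n²≤2^[2+n] d))) ⟩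
  tower 2 (3 + d)   ∎
  where
  open ≤-Reasoning
  k≤d : k ≤ d
  k≤d = ≤-trans (m≤m+n k 0) k+0≤d
typeCount≤tower d k (suc r) k+1+r≤d = begin
  typeCount k (suc r)     ≡⟨ typeCount-suc k r ⟩
  2 ^ typeCount (suc k) r ≤⟨ ^-monoʳ-≤ 2 (typeCount≤tower d (suc k) r (m+1+n≤o⇒1+m+n≤o k r k+1+r≤d)) ⟩
  tower (suc r) (tower 2 (3 + d)) ∎
  where open ≤-Reasoning

witnessBound≤square : ∀ d k r → k + suc r ≤ d →
  witnessBound k (suc r) ≤ tower r (tower 2 (3 + d)) * tower r (tower 2 (3 + d))
witnessBound≤square d k zero k+1≤d = begin
  typeCount (suc k) 0 * 1 ≡⟨ *-identityʳ _ ⟩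
  typeCount (suc k) 0     ≤⟨ typeCount≤tower d (suc k) 0 (m+1+n≤o⇒1+m+n≤o k 0 k+1≤d) ⟩
  Y                       ≤⟨ m≤m*n Y Y {{>-nonZero (≤-trans (s≤s z≤n) (5≤tower2 d))}} ⟩
  Y * Y                   ∎
  where
  open ≤-Reasoning
  Y : ℕ
  Y = tower 2 (3 + d)
witnessBound≤square d k (suc r) k+2+r≤d = begin
  typeCount (suc k) (suc r) * suc (witnessBound (suc k) (suc r))
    ≤⟨ *-mono-≤ (typeCount≤tower d (suc k) (suc r) fits)
                (s≤s (witnessBound≤square d (suc k) r fits)) ⟩
  2 ^ t * suc (t * t)
    ≤⟨ *-monoʳ-≤ (2 ^ t) (1+n²≤2^n (≤⇒≤′ (≤-trans (5≤tower2 d) (x≤tower r _)))) ⟩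
  2 ^ t * 2 ^ t ∎
  where
  open ≤-Reasoning
  t : ℕ
  t = tower r (tower 2 (3 + d))
  fits : suc k + suc r ≤ d
  fits = m+1+n≤o⇒1+m+n≤o k (suc r) k+2+r≤d

witnessBound≤tower : ∀ r → witnessBound 0 (suc r) ≤ tower (2 + r) (5 + r)
witnessBound≤tower r = begin
  witnessBound 0 (suc r)    ≤⟨ witnessBound≤square (suc r) 0 r ≤-refl ⟩
  tower r Y * tower r Y     ≤⟨ tower-square r (≤-trans (s≤s (s≤s z≤n)) (5≤tower2 (suc r))) ⟩
  tower r (Y * Y)           ≡⟨ cong (tower r) Y*Y≡tower2 ⟩
  tower r (tower 2 (5 + r)) ≡⟨ tower-+ r 2 (5 + r) ⟩
  tower (r + 2) (5 + r)     ≡⟨ cong (λ h → tower h (5 + r)) (+-comm r 2) ⟩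
  tower (2 + r) (5 + r)     ∎
  where
  open ≤-Reasoning
  Y : ℕ
  Y = tower 2 (4 + r)
  Y*Y≡tower2 : Y * Y ≡ tower 2 (5 + r)
  Y*Y≡tower2 =
    trans (sym (^-distribˡ-+-* 2 (2 ^ (4 + r)) _)) (cong (2 ^_) (2^n+2^n≡2^[1+n] (4 + r)))

-- The iterated logarithm

⌈log₂[2+n]⌉≤1+n : ∀ n → ⌈log₂ suc (suc n) ⌉ ≤ suc n
⌈log₂[2+n]⌉≤1+n n =
  ≤-trans (⌈log₂⌉-mono-≤ (n<2^n (suc n))) (≤-reflexive (⌈log₂2^n⌉≡n (suc n)))

-- Both fuels only need to be adequate, so in particular logStar′ f x = logStar x for x ≤ f.
logStar′-mono : ∀ f g {x y} → x ≤ y → x ≤ f → y ≤ g → logStar′ f x ≤ logStar′ g y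
logStar′-mono zero    _       _ _ _ = z≤n
logStar′-mono (suc f) _ {zero}        _ _ _ = z≤n
logStar′-mono (suc f) _ {suc zero}    _ _ _ = z≤n
logStar′-mono (suc f) _ {suc (suc x)} {zero}     () _ _
logStar′-mono (suc f) _ {suc (suc x)} {suc zero} (s≤s ()) _ _
logStar′-mono (suc f) zero {suc (suc x)} {suc (suc y)} _ _ ()
logStar′-mono (suc f) (suc g) {suc (suc x)} {suc (suc y)} x≤y (s≤s x<f) (s≤s y<g) =
  s≤s (logStar′-mono f g (⌈log₂⌉-mono-≤ x≤y)
        (≤-trans (⌈log₂[2+n]⌉≤1+n x) x<f) (≤-trans (⌈log₂[2+n]⌉≤1+n y) y<g))

logStar-mono : ∀ {m n} → m ≤ n → logStar m ≤ logStar n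
logStar-mono {m} {n} m≤n = logStar′-mono m n m≤n ≤-refl ≤-refl

logStar≤1+logStar[⌈log₂n⌉] : ∀ n → logStar n ≤ suc (logStar ⌈log₂ n ⌉)
logStar≤1+logStar[⌈log₂n⌉] zero          = z≤n
logStar≤1+logStar[⌈log₂n⌉] (suc zero)    = z≤n
logStar≤1+logStar[⌈log₂n⌉] (suc (suc n)) =
  s≤s (logStar′-mono (suc n) _ ≤-refl (⌈log₂[2+n]⌉≤1+n n) ≤-refl)

logStar[2^n]≤1+logStar[n] : ∀ n → logStar (2 ^ n) ≤ suc (logStar n)
logStar[2^n]≤1+logStar[n] n =
  subst (λ x → logStar (2 ^ n) ≤ suc (logStar x)) (⌈log₂2^n⌉≡n n)
        (logStar≤1+logStar[⌈log₂n⌉] (2 ^ n))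

logStar[1+n]≤1+logStar[n] : ∀ n → logStar (suc n) ≤ suc (logStar n)
logStar[1+n]≤1+logStar[n] zero    = z≤n
logStar[1+n]≤1+logStar[n] (suc n) =
  ≤-trans (logStar≤1+logStar[⌈log₂n⌉] (suc (suc n))) (s≤s (logStar-mono (⌈log₂[2+n]⌉≤1+n n)))

logStar-tower : ∀ h x → logStar (tower h x) ≤ h + logStar x
logStar-tower zero    x = ≤-refl
logStar-tower (suc h) x = ≤-trans (logStar[2^n]≤1+logStar[n] _) (s≤s (logStar-tower h x))

n∸logStar[n]-mono : ∀ {m n} → m ≤′ n → m ∸ logStar m ≤ n ∸ logStar n
n∸logStar[n]-mono ≤′-refl             = ≤-refl
n∸logStar[n]-mono (≤′-step {n} m≤′n) =
  ≤-trans (n∸logStar[n]-mono m≤′n) (∸-monoʳ-≤ (suc n) (logStar[1+n]≤1+logStar[n] n))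

logStar-gap : ∀ {n} r → n ≤ tower (2 + r) (5 + r) → logStar n ∸ logStar (logStar n) ≤ 2 + r
logStar-gap {n} r n≤tower = begin
  logStar n ∸ logStar (logStar n) ≤⟨ n∸logStar[n]-mono (≤⇒≤′ logStar[n]≤S) ⟩
  S ∸ logStar S                   ≤⟨ ∸-monoʳ-≤ S (logStar-mono 5+r≤S) ⟩
  S ∸ logStar (5 + r)             ≡⟨ m+n∸n≡m (2 + r) (logStar (5 + r)) ⟩
  2 + r                           ∎
  where
  open ≤-Reasoning
  S : ℕ
  S = 2 + r + logStar (5 + r)
  logStar[n]≤S : logStar n ≤ S
  logStar[n]≤S = ≤-trans (logStar-mono n≤tower) (logStar-tower (2 + r) (5 + r))
  -- logStar 5 evaluates to 3.
  5+r≤S : 5 + r ≤ S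
  5+r≤S = ≤-trans (≤-reflexive (cong (2 +_) (+-comm 3 r)))
                  (+-monoʳ-≤ (2 + r) (logStar-mono {5} {5 + r} (m≤m+n 5 r)))

logStar-bound : ∀ {n} d → n ≤ witnessBound 0 d → logStar n ∸ logStar (logStar n) ∸ 1 ≤ d
logStar-bound zero    z≤n      = z≤n
logStar-bound (suc r) n≤bound =
  ∸-monoˡ-≤ 1 (logStar-gap r (≤-trans n≤bound (witnessBound≤tower r)))

theorem2 : ∀ (n : ℕ) → 1 ≤ n → (G : Digraph n) →
    (Φ : Sentence) → ZeroAlt Φ → Defines G Φ →
    logStar n ∸ logStar (logStar n) ∸ 1 ≤ depth Φ
theorem2 (suc zero)    _ _ _ _ _ = z≤n
theorem2 (suc (suc n)) _ G Φ zeroAlt defines =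
  logStar-bound (depth Φ) (definable⇒≤witnessBound G Φ zeroAlt defines)
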